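{- Let $m\ge 5$ and let $\chi:E(K_m)\to\mathbb{Z}_3$ be a coloring such that at every vertex $v$, the edges incident to $v$ use at most two colors, and if they use two colors then one of these colors appears on exactly one edge incident to $v$ (i.e., the pattern $a,a,b,b$ with $a\ne b$ never occurs at a vertex). Then either (i) there is a color $a$ such that the edges of colors other than $a$ form a matching, or (ii) $K_m$ contains a monochromatic complete subgraph on $m-1$ vertices. -}

module Defs where

open import Data.Nat using (ℕ; _≤_)
open import Data.Fin using (Fin; _≟_)
open import Data.Fin.Subset using (Subset; _∈_; ∣_∣)
open import Data.List using (length; filter; allFin)
open import Data.Product using (_×_; ∃; ∃-syntax)
open import Data.Sum using (_⊎_)
open import Relation.Nullary using (¬_)
open import Relation.Nullary.Decidable using (¬?; _×-dec_)
open import Relation.Binary.PropositionalEquality using (_≡_; _≢_)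

-- Colors: elements of ℤ₃, represented by Fin 3 (only used as labels).
Color : Set
Color = Fin 3

-- An edge colouring of K_m on vertex set Fin m: a function on ordered pairs,
-- required (in the statement) to be symmetric on pairs of distinct vertices;
-- values on the diagonal are irrelevant (loops are not edges of K_m).
Coloring : ℕ → Set
Coloring m = Fin m → Fin m → Color

Symmetric : ∀ {m} → Coloring m → Set
Symmetric {m} χ = ∀ (u v : Fin m) → u ≢ v → χ u v ≡ χ v u

UsedAt : ∀ {m} → Coloring m → Fin m → Color → Set
UsedAt {m} χ v c = ∃[ u ] (u ≢ v × χ v u ≡ c)

degC : ∀ {m} → Coloring m → Fin m → Color → ℕ
degC {m} χ v c = length (filter (λ u → ¬? (u ≟ v) ×-dec (χ v u ≟ c)) (allFin m))

LocalCondition : ∀ {m} → Coloring m → Fin m → Set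
LocalCondition {m} χ v =
  (∃[ a ] ∃[ b ] (∀ (u : Fin m) → u ≢ v → (χ v u ≡ a ⊎ χ v u ≡ b)))
  × (∀ (a b : Color) → a ≢ b → UsedAt χ v a → UsedAt χ v b →
       (degC χ v a ≡ 1 ⊎ degC χ v b ≡ 1))

NonAIsMatching : ∀ {m} → Coloring m → Color → Set
NonAIsMatching {m} χ a =
  ∀ (v u w : Fin m) → u ≢ v → w ≢ v → χ v u ≢ a → χ v w ≢ a → u ≡ w

Monochromatic : ∀ {m} → Coloring m → Subset m → Color → Set
Monochromatic {m} χ S c =
  ∀ (u w : Fin m) → u ∈ S → w ∈ S → u ≢ w → χ u w ≡ c

{-# OPTIONS --safe #-}
-- By the local condition every vertex v has a major colour M v, carried by all edges at v
-- except possibly the one to an exceptional neighbour. An edge joining vertices of different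
-- major colours cannot carry both, so it is exceptional at one of its ends; since each vertex
-- has only one exceptional edge, no K₃,₂ can separate a major class from its complement.
-- With only three colours some major class has two members, so its complement has at most
-- one, as otherwise any fifth vertex would complete a K₃,₂. If the complement is empty, the
-- edges off the common major colour are exceptional edges and form a matching; if it is a
-- single vertex z, the other m − 1 vertices span a monochromatic clique.
module Submission where

open import Defs
open import Data.Nat using (ℕ; _≤_; _<_; _∸_)
open import Data.Nat.Properties using (≤-trans; n≤1+n)
open import Data.Fin using (Fin; zero; suc; _≟_)
open import Data.Fin.Properties using (any?; all?; ¬∀⟶∃¬; pigeonhole; <⇒≢; <⇒notInjective)
open import Data.Fin.Subset using (∣_∣; ∁; ⁅_⁆; _∈_)
open import Data.Fin.Subset.Properties using (x∈⁅x⁆; x∈∁p⇒x∉p; ∣⁅x⁆∣≡1; ∣∁p∣≡n∸∣p∣)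
open import Data.List using (List; []; _∷_; length; filter; allFin)
open import Data.List.Membership.Propositional using () renaming (_∈_ to _∈ₗ_)
open import Data.List.Membership.Propositional.Properties using (∈-filter⁺; ∈-allFin)
open import Data.List.Relation.Unary.Any using (here)
open import Data.Vec using (_∷_; []; lookup)
open import Data.Product using (_×_; ∃-syntax; _,_; proj₁; proj₂)
open import Data.Sum using (_⊎_; inj₁; inj₂; [_,_]; fromInj₂; swap; reduce)
open import Data.Empty using (⊥; ⊥-elim)
open import Function using (_∘_)
open import Function.Definitions using (Injective)
open import Relation.Nullary using (¬_; Dec; yes; no; contradiction)
open import Relation.Unary using (Decidable)
open import Relation.Nullary.Decidable using (¬?; _×-dec_; decidable-stable)
open import Relation.Binary.PropositionalEquality using (_≡_; _≢_; refl; sym; trans; cong; ≢-sym)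

length≡1⇒∈-unique : ∀ {A : Set} {xs : List A} {x y : A} →
                     length xs ≡ 1 → x ∈ₗ xs → y ∈ₗ xs → x ≡ y
length≡1⇒∈-unique {xs = _ ∷ []} _ (here refl) (here refl) = refl

three-distinct-not-in-pair : ∀ {A : Set} {x y z a b : A} → x ≢ y → x ≢ z → y ≢ z →
                             x ≡ a ⊎ x ≡ b → y ≡ a ⊎ y ≡ b → z ≡ a ⊎ z ≡ b → ⊥
three-distinct-not-in-pair x≢y _   _   (inj₁ refl) (inj₁ refl) _           = x≢y refl
three-distinct-not-in-pair x≢y _   _   (inj₂ refl) (inj₂ refl) _           = x≢y refl
three-distinct-not-in-pair _   x≢z _   (inj₁ refl) (inj₂ refl) (inj₁ refl) = x≢z refl
three-distinct-not-in-pair _   _   y≢z (inj₁ refl) (inj₂ refl) (inj₂ refl) = y≢z refl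
three-distinct-not-in-pair _   _   y≢z (inj₂ refl) (inj₁ refl) (inj₁ refl) = y≢z refl
three-distinct-not-in-pair _   x≢z _   (inj₂ refl) (inj₁ refl) (inj₂ refl) = x≢z refl

<⇒∃-outside-image : ∀ {k m} → k < m → (xs : Fin k → Fin m) → ∃[ y ] (∀ j → y ≢ xs j)
<⇒∃-outside-image {k} k<m xs with any? (λ y → all? (λ j → ¬? (y ≟ xs j)))
... | yes outside = outside
... | no ¬outside = ⊥-elim (<⇒notInjective k<m preimage-injective)
  where
  preimage : ∀ y → ∃[ j ] (y ≡ xs j)
  preimage y with ¬∀⟶∃¬ k _ (λ j → ¬? (y ≟ xs j)) (λ y∉ → ¬outside (y , y∉))
  ... | j , ¬y≢xsj = j , decidable-stable (y ≟ xs j) ¬y≢xsj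

  preimage-injective : Injective _≡_ _≡_ (proj₁ ∘ preimage)
  preimage-injective {y} {y′} eq =
    trans (proj₂ (preimage y)) (trans (cong xs eq) (sym (proj₂ (preimage y′))))

∣∁⁅x⁆∣≡n∸1 : ∀ {n} (x : Fin n) → ∣ ∁ ⁅ x ⁆ ∣ ≡ n ∸ 1
∣∁⁅x⁆∣≡n∸1 {n} x = trans (∣∁p∣≡n∸∣p∣ ⁅ x ⁆) (cong (n ∸_) (∣⁅x⁆∣≡1 x))

x∈∁⁅y⁆⇒x≢y : ∀ {n} {x y : Fin n} → x ∈ ∁ ⁅ y ⁆ → x ≢ y
x∈∁⁅y⁆⇒x≢y {x = x} x∈ refl = x∈∁p⇒x∉p x∈ (x∈⁅x⁆ x)

module _ {m : ℕ} (χ : Coloring m) where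

  usedAt? : ∀ v c → Dec (UsedAt χ v c)
  usedAt? v c = any? (λ u → ¬? (u ≟ v) ×-dec (χ v u ≟ c))

  degC≡1⇒unique : ∀ {v c u w} → degC χ v c ≡ 1 → u ≢ v → w ≢ v →
                  χ v u ≡ c → χ v w ≡ c → u ≡ w
  degC≡1⇒unique {v} {c} {u} {w} deg u≢v w≢v χvu≡c χvw≡c =
    length≡1⇒∈-unique deg (∈-filter⁺ P? (∈-allFin u) (u≢v , χvu≡c))
                          (∈-filter⁺ P? (∈-allFin w) (w≢v , χvw≡c))
    where
    P? : Decidable (λ x → x ≢ v × χ v x ≡ c)
    P? x = ¬? (x ≟ v) ×-dec (χ v x ≟ c)

  StarColoredExcept : Fin m → Color → Fin m → Set
  StarColoredExcept v c e = ∀ u → u ≢ v → u ≢ e → χ v u ≡ c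

  TwoColored : Fin m → Color → Color → Set
  TwoColored v a b = ∀ u → u ≢ v → χ v u ≡ a ⊎ χ v u ≡ b

  unused⇒starColored : ∀ {v a b} e → TwoColored v a b → ¬ UsedAt χ v a →
                       StarColoredExcept v b e
  unused⇒starColored _ cov unused u u≢v _ =
    fromInj₂ (λ χvu≡a → contradiction (u , u≢v , χvu≡a) unused) (cov u u≢v)

  degC≡1⇒starColored : ∀ {v a b} → TwoColored v a b → degC χ v a ≡ 1 →
                       (used : UsedAt χ v a) → StarColoredExcept v b (proj₁ used)
  degC≡1⇒starColored cov deg (e , e≢v , χve≡a) u u≢v u≢e =
    fromInj₂ (λ χvu≡a → contradiction (degC≡1⇒unique deg u≢v e≢v χvu≡a χve≡a) u≢e)
             (cov u u≢v)

  localCondition⇒starColored : ∀ v → LocalCondition χ v →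
                               ∃[ c ] ∃[ e ] StarColoredExcept v c e
  localCondition⇒starColored v ((a , b , cov) , oneIsSingle)
    with usedAt? v a | usedAt? v b | a ≟ b
  ... | no ¬a | _     | _       = b , v , unused⇒starColored v cov ¬a
  ... | yes _ | no ¬b | _       = a , v , unused⇒starColored v (λ u → swap ∘ cov u) ¬b
  ... | yes _ | yes _ | yes refl = a , v , λ u u≢v _ → reduce (cov u u≢v)
  ... | yes ua | yes ub | no a≢b =
    [ (λ degA → b , proj₁ ua , degC≡1⇒starColored cov degA ua)
    , (λ degB → a , proj₁ ub , degC≡1⇒starColored (λ u → swap ∘ cov u) degB ub)
    ] (oneIsSingle a b a≢b ua ub)

module Majors {m : ℕ} (χ : Coloring m) (symχ : Symmetric χ)
              (M : Fin m → Color) (exc : Fin m → Fin m)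
              (star : ∀ v → StarColoredExcept χ v (M v) (exc v)) where

  offMajor⇒exception : ∀ {v u} → u ≢ v → χ v u ≢ M v → u ≡ exc v
  offMajor⇒exception {v} {u} u≢v off with u ≟ exc v
  ... | yes u≡e = u≡e
  ... | no u≢e = contradiction (star v u u≢v u≢e) off

  disagree⇒exception : ∀ {p q} → M p ≢ M q → q ≡ exc p ⊎ p ≡ exc q
  disagree⇒exception {p} {q} Mp≢Mq with χ p q ≟ M p
  ... | no off = inj₁ (offMajor⇒exception (Mp≢Mq ∘ cong M ∘ sym) off)
  ... | yes χpq≡Mp = inj₂ (offMajor⇒exception p≢q χqp≢Mq)
    where
    p≢q : p ≢ q
    p≢q = Mp≢Mq ∘ cong M

    χqp≢Mq : χ q p ≢ M q
    χqp≢Mq χqp≡Mq = Mp≢Mq (trans (sym χpq≡Mp) (trans (symχ p q p≢q) χqp≡Mq))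

  disagreeWithBoth⇒exception : ∀ {p q₁ q₂} → q₁ ≢ q₂ → M p ≢ M q₁ → M p ≢ M q₂ →
                               p ≡ exc q₁ ⊎ p ≡ exc q₂
  disagreeWithBoth⇒exception q₁≢q₂ d₁ d₂
    with disagree⇒exception d₁ | disagree⇒exception d₂
  ... | inj₂ p≡e₁ | _         = inj₁ p≡e₁
  ... | inj₁ _    | inj₂ p≡e₂ = inj₂ p≡e₂
  ... | inj₁ q₁≡e | inj₁ q₂≡e = contradiction (trans q₁≡e (sym q₂≡e)) q₁≢q₂

  no-K₃,₂ : ∀ {P Q : Fin m → Set} → (∀ {p q} → P p → Q q → M p ≢ M q) →
            ∀ {p₁ p₂ p₃ q₁ q₂} → P p₁ → P p₂ → P p₃ → Q q₁ → Q q₂ →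
            p₁ ≢ p₂ → p₁ ≢ p₃ → p₂ ≢ p₃ → q₁ ≢ q₂ → ⊥
  no-K₃,₂ {P} apart {q₁ = q₁} {q₂} P₁ P₂ P₃ Q₁ Q₂ p₁≢p₂ p₁≢p₃ p₂≢p₃ q₁≢q₂ =
    three-distinct-not-in-pair p₁≢p₂ p₁≢p₃ p₂≢p₃
      (exception P₁) (exception P₂) (exception P₃)
    where
    exception : ∀ {p} → P p → p ≡ exc q₁ ⊎ p ≡ exc q₂
    exception Pp = disagreeWithBoth⇒exception q₁≢q₂ (apart Pp Q₁) (apart Pp Q₂)

  major≡≢⇒≢ : ∀ {a p q} → M p ≡ a → M q ≢ a → M p ≢ M q
  major≡≢⇒≢ Mp≡a Mq≢a Mp≡Mq = Mq≢a (trans (sym Mp≡Mq) Mp≡a)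

  no-2+2 : 5 ≤ m → ∀ {a p₁ p₂ q₁ q₂} → M p₁ ≡ a → M p₂ ≡ a → M q₁ ≢ a → M q₂ ≢ a →
           p₁ ≢ p₂ → q₁ ≢ q₂ → ⊥
  no-2+2 5≤m {a} {p₁} {p₂} {q₁} {q₂} P₁ P₂ Q₁ Q₂ p₁≢p₂ q₁≢q₂
    with <⇒∃-outside-image 5≤m (lookup (p₁ ∷ p₂ ∷ q₁ ∷ q₂ ∷ []))
  ... | w , fresh with M w ≟ a
  ... | yes Pw = no-K₃,₂ {P = λ v → M v ≡ a} major≡≢⇒≢ P₁ P₂ Pw Q₁ Q₂
                   p₁≢p₂ (≢-sym (fresh zero)) (≢-sym (fresh (suc zero))) q₁≢q₂
  ... | no Qw  = no-K₃,₂ {Q = λ v → M v ≡ a} (λ Qq Pp → ≢-sym (major≡≢⇒≢ Pp Qq)) Q₁ Q₂ Qw P₁ P₂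
                   q₁≢q₂ (≢-sym (fresh (suc (suc zero)))) (≢-sym (fresh (suc (suc (suc zero)))))
                   p₁≢p₂

  uniformMajor⇒matching : ∀ {a} → (∀ v → M v ≡ a) → NonAIsMatching χ a
  uniformMajor⇒matching {a} uniform v u w u≢v w≢v χvu≢a χvw≢a =
    trans (offMajor⇒exception u≢v (χvu≢a ∘ toA)) (sym (offMajor⇒exception w≢v (χvw≢a ∘ toA)))
    where
    toA : ∀ {c} → c ≡ M v → c ≡ a
    toA c≡Mv = trans c≡Mv (uniform v)

  -- An off-colour edge uw would make u and w each other's exceptional neighbour,
  -- leaving neither free to be the exceptional neighbour of z.
  soleDissenter⇒monochromatic : ∀ {a z} → M z ≢ a → (∀ x → x ≢ z → M x ≡ a) →
                                Monochromatic χ (∁ ⁅ z ⁆) a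
  soleDissenter⇒monochromatic {a} {z} Mz≢a others u w u∈ w∈ u≢w with χ u w ≟ a
  ... | yes χuw≡a = χuw≡a
  ... | no χuw≢a = ⊥-elim (
    [ (λ z≡eu → w≢z (trans w≡eu (sym z≡eu))) , (λ z≡ew → u≢z (trans u≡ew (sym z≡ew))) ]
      (disagreeWithBoth⇒exception u≢w (≢-sym (major≡≢⇒≢ (others u u≢z) Mz≢a))
                                        (≢-sym (major≡≢⇒≢ (others w w≢z) Mz≢a))))
    where
    u≢z : u ≢ z
    u≢z = x∈∁⁅y⁆⇒x≢y u∈

    w≢z : w ≢ z
    w≢z = x∈∁⁅y⁆⇒x≢y w∈

    w≡eu : w ≡ exc u
    w≡eu = offMajor⇒exception (≢-sym u≢w) (λ χuw≡Mu → χuw≢a (trans χuw≡Mu (others u u≢z)))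

    u≡ew : u ≡ exc w
    u≡ew = offMajor⇒exception u≢w
             (λ χwu≡Mw → χuw≢a (trans (symχ u w u≢w) (trans χwu≡Mw (others w w≢z))))

  dichotomy : 5 ≤ m → (∃[ a ] NonAIsMatching χ a)
                      ⊎ (∃[ S ] ∃[ c ] (∣ S ∣ ≡ m ∸ 1 × Monochromatic χ S c))
  dichotomy 5≤m with pigeonhole (≤-trans (n≤1+n 4) 5≤m) M
  ... | i , j , i<j , Mi≡Mj with all? (λ v → M v ≟ M i)
  ... | yes uniform = inj₁ (M i , uniformMajor⇒matching uniform)
  ... | no ¬uniform with ¬∀⟶∃¬ m _ (λ v → M v ≟ M i) ¬uniform
  ... | z , Mz≢a with any? (λ x → ¬? (x ≟ z) ×-dec ¬? (M x ≟ M i))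
  ... | yes (x , x≢z , Mx≢a) =
    ⊥-elim (no-2+2 5≤m refl (sym Mi≡Mj) Mz≢a Mx≢a (<⇒≢ i<j) (≢-sym x≢z))
  ... | no ¬second =
    inj₂ (∁ ⁅ z ⁆ , M i , ∣∁⁅x⁆∣≡n∸1 z , soleDissenter⇒monochromatic Mz≢a others)
    where
    others : ∀ x → x ≢ z → M x ≡ M i
    others x x≢z = decidable-stable (M x ≟ M i) (λ Mx≢a → ¬second (x , x≢z , Mx≢a))

lemma4p1 : (m : ℕ) → 5 ≤ m → (χ : Coloring m) → Symmetric χ →
    (∀ (v : Fin m) → LocalCondition χ v) →
    (∃[ a ] NonAIsMatching χ a)
    ⊎ (∃[ S ] ∃[ c ] (∣ S ∣ ≡ m ∸ 1 × Monochromatic χ S c))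
lemma4p1 m 5≤m χ symχ local = Majors.dichotomy χ symχ major exception star 5≤m
  where
  starColored : ∀ v → ∃[ c ] ∃[ e ] StarColoredExcept χ v c e
  starColored v = localCondition⇒starColored χ v (local v)

  major : Fin m → Color
  major v = proj₁ (starColored v)

  exception : Fin m → Fin m
  exception v = proj₁ (proj₂ (starColored v))

  star : ∀ v → StarColoredExcept χ v (major v) (exception v)
  star v = proj₂ (proj₂ (starColored v))
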